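{- Let $\mathcal{O}$ be an order in a definite quaternion algebra $\mathbb{H}$ over $\mathbb{Q}$ and $d\ge0$ an integer. Then $e_d=0$ unless $d\equiv0\pmod{\omega(\mathcal{O})}$.
   Context: $\Delta(x)=(\mathrm{tr}\,x)^2-4\mathrm{N}(x)$ with $\mathrm{N},\mathrm{tr}$ reduced norm and trace; $\omega(\mathcal{O})=\gcd\{\Delta(x):x\in\mathcal{O}\}$ (positive). Left $\mathcal{O}$-ideals are lattices locally of the form $\mathcal{O}_qx_q$; classes $[\mathfrak{a}]$ modulo right multiplication by $\mathbb{H}^\times$ form a finite set $\mathcal{I}(\mathcal{O})$, the basis of $\mathcal{M}(\mathcal{O})$; height pairing $\langle[\mathfrak{a}],[\mathfrak{b}]\rangle=\frac12\#\{x\in\mathbb{H}^\times:\mathfrak{a}x=\mathfrak{b}\}$, $[\mathfrak{a}]^\vee=[\mathfrak{a}]/\langle[\mathfrak{a}],[\mathfrak{a}]\rangle$. For $d$ with $-d\equiv0,1\pmod4$, $a_d([\mathfrak{a}])$ is the number of $\mathbb{Z}$-translation orbits of $\{x\in\mathcal{O}_r(\mathfrak{a}):\Delta(x)=-d\}$, where $\mathcal{O}_r(\mathfrak{a})$ is the right order; otherwise $a_d=0$. $e_d=\sum_{[\mathfrak{a}]\in\mathcal{I}(\mathcal{O})}a_d([\mathfrak{a}])[\mathfrak{a}]^\vee$. -}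

module Defs where

open import Data.Nat as ℕ using (ℕ)
open import Data.Nat.Divisibility using (_∣_)
open import Data.Integer as ℤ using (ℤ; +_)
open import Data.Rational using (ℚ; 0ℚ; 1ℚ; _+_; _*_; _-_; -_; _/_)
open import Data.Fin using (Fin; zero; suc)
open import Data.Product using (Σ; ∃; _×_; _,_)
open import Data.Sum using (_⊎_)
open import Relation.Nullary using (¬_)
open import Relation.Binary.PropositionalEquality using (_≡_; _≢_)

ℤ→ℚ : ℤ → ℚ
ℤ→ℚ z = z / 1

ℕ→ℚ : ℕ → ℚ
ℕ→ℚ n = ℤ→ℚ (+ n)

-- Elements of ℚ^4, coordinates w.r.t. the standard basis 1, i, j, k
record Quat : Set where
  constructor quat
  field
    c₀ c₁ c₂ c₃ : ℚ
open Quat public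

-- The quaternion algebra H = (a,b)_ℚ : i² = a, j² = b, ij = -ji = k.
module QuaternionAlgebra (a b : ℚ) where

  0H : Quat
  0H = quat 0ℚ 0ℚ 0ℚ 0ℚ

  1H : Quat
  1H = quat 1ℚ 0ℚ 0ℚ 0ℚ

  _⊕_ : Quat → Quat → Quat
  quat x₀ x₁ x₂ x₃ ⊕ quat y₀ y₁ y₂ y₃ = quat (x₀ + y₀) (x₁ + y₁) (x₂ + y₂) (x₃ + y₃)

  _·_ : ℚ → Quat → Quat
  r · quat x₀ x₁ x₂ x₃ = quat (r * x₀) (r * x₁) (r * x₂) (r * x₃)

  -- multiplication in (a,b)_ℚ (k² = -ab, ik = a j, kj = -b i, etc.)
  _⊗_ : Quat → Quat → Quat
  quat x₀ x₁ x₂ x₃ ⊗ quat y₀ y₁ y₂ y₃ = quat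
    (x₀ * y₀ + a * x₁ * y₁ + b * x₂ * y₂ - a * b * x₃ * y₃)
    (x₀ * y₁ + x₁ * y₀ - b * x₂ * y₃ + b * x₃ * y₂)
    (x₀ * y₂ + x₂ * y₀ + a * x₁ * y₃ - a * x₃ * y₁)
    (x₀ * y₃ + x₃ * y₀ + x₁ * y₂ - x₂ * y₁)

  trd : Quat → ℚ
  trd x = c₀ x + c₀ x

  nrd : Quat → ℚ
  nrd x = c₀ x * c₀ x - a * c₁ x * c₁ x - b * c₂ x * c₂ x + a * b * c₃ x * c₃ x

  Δ : Quat → ℚ
  Δ x = trd x * trd x - ℕ→ℚ 4 * nrd x

  comb : (Fin 4 → ℚ) → (Fin 4 → Quat) → Quat
  comb c v = (c zero · v zero) ⊕ ((c (suc zero) · v (suc zero))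
             ⊕ ((c (suc (suc zero)) · v (suc (suc zero)))
             ⊕ (c (suc (suc (suc zero))) · v (suc (suc (suc zero))))))

  -- A (full) lattice in H: the ℤ-span of a ℚ-basis of H
  record Lattice : Set where
    field
      basis : Fin 4 → Quat
      independent : (c : Fin 4 → ℚ) → comb c basis ≡ 0H → (i : Fin 4) → c i ≡ 0ℚ

  _∈L_ : Quat → Lattice → Set
  x ∈L L = ∃ λ (c : Fin 4 → ℤ) → x ≡ comb (λ i → ℤ→ℚ (c i)) (Lattice.basis L)

  record Order : Set where
    field
      lattice : Lattice
      one∈ : 1H ∈L lattice
      mul∈ : ∀ x y → x ∈L lattice → y ∈L lattice → (x ⊗ y) ∈L lattice
  open Order public

  _∈O_ : Quat → Order → Set
  x ∈O O = x ∈L lattice O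

  -- Localisation of a lattice at a prime q: L_(q) = ℤ_(q) ⊗ L inside H
  _∈_at_ : Quat → Lattice → ℕ → Set
  y ∈ L at q = ∃ λ (m : ℕ) → (¬ (q ∣ m)) × ((ℕ→ℚ m · y) ∈L L)

  -- Left O-ideal: a lattice 𝔞 with 𝔞_(q) = O_(q) x_q for every prime q
  IsLeftIdeal : Order → Lattice → Set
  IsLeftIdeal O 𝔞 = (q : ℕ) → Prime q →
    ∃ λ (x : Quat) → (x ≢ 0H) ×
      ((y : Quat) → (y ∈ 𝔞 at q → ∃ λ z → (z ∈ lattice O at q) × (y ≡ z ⊗ x))
                  × ((∃ λ z → (z ∈ lattice O at q) × (y ≡ z ⊗ x)) → y ∈ 𝔞 at q))
    where open import Data.Nat.Primality using (Prime)

  _∈Oᵣ_ : Quat → Lattice → Set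
  x ∈Oᵣ 𝔞 = (y : Quat) → y ∈L 𝔞 → (y ⊗ x) ∈L 𝔞

  _divides_ : ℕ → ℚ → Set
  w divides r = ∃ λ (z : ℤ) → r ≡ ℤ→ℚ (+ w ℤ.* z)

  IsOmega : Order → ℕ → Set
  IsOmega O w = (w ≢ 0)
    × ((x : Quat) → x ∈O O → w divides Δ x)
    × ((w' : ℕ) → ((x : Quat) → x ∈O O → w' divides Δ x) → w' ∣ w)

  DiscAdmissible : ℕ → Set
  DiscAdmissible d = ∃ λ (k : ℤ) → (ℤ.- (+ d) ≡ + 4 ℤ.* k) ⊎ (ℤ.- (+ d) ≡ + 4 ℤ.* k ℤ.+ + 1)

  -- a_d([𝔞]) = 0 : either -d is not a discriminant, or the set of ℤ-translation
  -- orbits of { x ∈ O_r(𝔞) : Δ(x) = -d } is empty, i.e. that set is empty.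
  aZero : ℕ → Lattice → Set
  aZero d 𝔞 = DiscAdmissible d → ¬ (∃ λ x → (x ∈Oᵣ 𝔞) × (Δ x ≡ - ℕ→ℚ d))

  -- e_d = Σ a_d([𝔞]) [𝔞]^∨ = 0 in the free ℚ-module M(O) on I(O): since the
  -- classes form a basis and ⟨[𝔞],[𝔞]⟩ > 0, this means a_d([𝔞]) = 0 for every class.
  eZero : Order → ℕ → Set
  eZero O d = (𝔞 : Lattice) → IsLeftIdeal O 𝔞 → aZero d 𝔞

-- Let x ∈ O_r(𝔞) with Δ(x) = -d and let q be a prime. Locally 𝔞_(q) = O_(q) y, so y x ∈ 𝔞_(q)
-- gives y x = z y with z ∈ O_(q). As H is definite, nrd y ≠ 0, so multiplicativity of nrd gives
-- nrd z = nrd x and nrd (z + 1) = nrd (x + 1); hence z and x have the same trace and Δ(z) = -d.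
-- Some m prime to q has m z ∈ O, so ω ∣ Δ(m z) = -m² d. Thus ω divides d in ℤ_(q) for every
-- prime q, which forces ω ∣ d.
module Submission where

open import Defs
open import Data.Nat using (ℕ)
open import Data.Nat.Divisibility using (_∣_)
open import Data.Rational using (ℚ; 0ℚ; _<_)
open import Relation.Nullary using (¬_)

open import Data.List using ([]; _∷_)
open import Data.List.Relation.Unary.All using (_∷_)
open import Data.Nat as ℕ using (NonZero; ≢-nonZero)
import Data.Nat.Properties as ℕ
open import Data.Nat.Coprimality as Coprimality using (coprime-/gcd; coprime-divisor; 1-coprimeTo)
open import Data.Nat.DivMod using (_/_; m/n*n≡m)
open import Data.Nat.Divisibility using (∣-trans; *-cancelʳ-∣; m∣m*n; ∣1⇒≡1)
open import Data.Nat.GCD using (gcd; gcd[m,n]∣m; gcd[m,n]∣n; gcd[m,n]≢0)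
open import Data.Nat.ListAction using (product)
open import Data.Nat.Primality using (Prime; euclidsLemma; ¬prime[1])
open import Data.Nat.Primality.Factorisation using (factorise)
open import Data.Integer as ℤ using (+_; -[1+_])
import Data.Integer.Properties as ℤ
open import Data.Rational as ℚ using (mkℚ; ↥_; 1ℚ; _≤_; _+_; _*_; _-_; -_; 1/_)
import Data.Rational.Properties as ℚ
open import Data.Rational.Properties using (+-mono-<-≤; +-mono-≤-<; +-mono-≤)
open import Data.Rational.Solver using (module +-*-Solver)
open +-*-Solver using (Polynomial; solve; _:=_; _:+_; _:*_; _:-_; :-_; con)
open import Data.Product using (∃-syntax; _×_; _,_; proj₁; proj₂)
open import Data.Sum using (inj₁; [_,_]′)
open import Function using (_∘_)
open import Data.Vec.N-ary using (N-ary; N-ary-level)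
open import Level using (0ℓ)
open import Relation.Binary.Definitions using (tri<; tri≈; tri>)
open import Relation.Binary.PropositionalEquality
open import Relation.Nullary using (yes; no; contradiction)

-- w divides d in every localisation ℤ₍ₚ₎, the multiplier m being a unit there.
_∣ₗ_ : ℕ → ℕ → Set
w ∣ₗ d = ∀ p → Prime p → ∃[ m ] ¬ p ∣ m × w ∣ m ℕ.* d

prime-divisor : ∀ n .{{_ : NonZero n}} → n ≢ 1 → ∃[ p ] Prime p × p ∣ n
prime-divisor n n≢1 with factorise n
... | record { factors = [] ; isFactorisation = n≡1 } = contradiction n≡1 n≢1
... | record { factors = p ∷ ps ; isFactorisation = n≡p*ps ; factorsPrime = p-prime ∷ _ } =
  p , p-prime , subst (p ∣_) (sym n≡p*ps) (m∣m*n (product ps))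

∣ₗ1⇒≡1 : ∀ {t} .{{_ : NonZero t}} → t ∣ₗ 1 → t ≡ 1
∣ₗ1⇒≡1 {t} t∣ₗ1 with t ℕ.≟ 1
... | yes t≡1 = t≡1
... | no t≢1 with prime-divisor t t≢1
... | p , p-prime , p∣t with t∣ₗ1 p p-prime
... | m , p∤m , t∣m*1 = contradiction (∣-trans p∣t (subst (t ∣_) (ℕ.*-identityʳ m) t∣m*1)) p∤m

-- Writing w = t g and d = s g with g = gcd w d, the number t is coprime to s, so t ∣ₗ 1.
∣ₗ⇒∣ : ∀ {w d} → w ≢ 0 → w ∣ₗ d → w ∣ d
∣ₗ⇒∣ {w} {d} w≢0 w∣ₗd = subst (_∣ d) g≡w (gcd[m,n]∣n w d)
  where
  g : ℕ
  g = gcd w d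
  instance
    g≢0 : NonZero g
    g≢0 = ≢-nonZero (gcd[m,n]≢0 w d (inj₁ w≢0))
  t s : ℕ
  t = w / g
  s = d / g
  w≡t*g : w ≡ t ℕ.* g
  w≡t*g = sym (m/n*n≡m (gcd[m,n]∣m w d))
  d≡s*g : d ≡ s ℕ.* g
  d≡s*g = sym (m/n*n≡m (gcd[m,n]∣n w d))
  instance
    t≢0 : NonZero t
    t≢0 = ≢-nonZero λ t≡0 → w≢0 (trans w≡t*g (cong (ℕ._* g) t≡0))
  t∣ₗ1 : t ∣ₗ 1
  t∣ₗ1 p p-prime with w∣ₗd p p-prime
  ... | m , p∤m , w∣m*d = m , p∤m , subst (t ∣_) (sym (ℕ.*-identityʳ m)) t∣m
    where
    t∣s*m : t ∣ s ℕ.* m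
    t∣s*m = *-cancelʳ-∣ g (subst₂ _∣_ w≡t*g (begin
      m ℕ.* d         ≡⟨ cong (m ℕ.*_) d≡s*g ⟩
      m ℕ.* (s ℕ.* g) ≡⟨ sym (ℕ.*-assoc m s g) ⟩
      m ℕ.* s ℕ.* g   ≡⟨ cong (ℕ._* g) (ℕ.*-comm m s) ⟩
      s ℕ.* m ℕ.* g   ∎) w∣m*d)
      where open ≡-Reasoning
    t∣m : t ∣ m
    t∣m = coprime-divisor (coprime-/gcd w d) t∣s*m
  g≡w : g ≡ w
  g≡w = begin
    g         ≡⟨ sym (ℕ.*-identityˡ g) ⟩
    1 ℕ.* g   ≡⟨ cong (ℕ._* g) (sym (∣ₗ1⇒≡1 t∣ₗ1)) ⟩
    t ℕ.* g   ≡⟨ sym w≡t*g ⟩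
    w         ∎
    where open ≡-Reasoning

ℤ→ℚ≡mkℚ : ∀ i → ℤ→ℚ i ≡ mkℚ i 0 (Coprimality.sym (1-coprimeTo ℤ.∣ i ∣))
ℤ→ℚ≡mkℚ (+ n)    = ℚ.normalize-coprime (Coprimality.sym (1-coprimeTo n))
ℤ→ℚ≡mkℚ -[1+ n ] = cong -_ (ℚ.normalize-coprime (Coprimality.sym (1-coprimeTo (ℕ.suc n))))

ℤ→ℚ-injective : ∀ {i j} → ℤ→ℚ i ≡ ℤ→ℚ j → i ≡ j
ℤ→ℚ-injective {i} {j} eq = cong ↥_ (trans (sym (ℤ→ℚ≡mkℚ i)) (trans eq (ℤ→ℚ≡mkℚ j)))

ℤ→ℚ-homo-* : ∀ i j → ℤ→ℚ i * ℤ→ℚ j ≡ ℤ→ℚ (i ℤ.* j)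
ℤ→ℚ-homo-* i j = cong₂ _*_ (ℤ→ℚ≡mkℚ i) (ℤ→ℚ≡mkℚ j)

ℤ→ℚ-homo-neg : ∀ i → - ℤ→ℚ i ≡ ℤ→ℚ (ℤ.- i)
ℤ→ℚ-homo-neg i = trans (cong -_ (ℤ→ℚ≡mkℚ i)) (sym (neg-mkℚ i))
  where
  neg-mkℚ : ∀ i → ℤ→ℚ (ℤ.- i) ≡ - mkℚ i 0 (Coprimality.sym (1-coprimeTo ℤ.∣ i ∣))
  neg-mkℚ (+ 0)        = ℤ→ℚ≡mkℚ (+ 0)
  neg-mkℚ (+ ℕ.suc n)  = ℤ→ℚ≡mkℚ -[1+ n ]
  neg-mkℚ -[1+ n ]     = ℤ→ℚ≡mkℚ (+ ℕ.suc n)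

ℕ→ℚ-homo-* : ∀ m n → ℕ→ℚ m * ℕ→ℚ n ≡ ℕ→ℚ (m ℕ.* n)
ℕ→ℚ-homo-* m n = trans (ℤ→ℚ-homo-* (+ m) (+ n)) (cong ℤ→ℚ (sym (ℤ.pos-* m n)))

*-cancelʳ-≡ : ∀ p q r .{{_ : ℚ.NonZero r}} → p * r ≡ q * r → p ≡ q
*-cancelʳ-≡ p q r pr≡qr = begin
  p                ≡⟨ sym (ℚ.*-identityʳ p) ⟩
  p * 1ℚ           ≡⟨ cong (p *_) (sym (ℚ.*-inverseʳ r)) ⟩
  p * (r * 1/ r)   ≡⟨ sym (ℚ.*-assoc p r (1/ r)) ⟩
  p * r * 1/ r     ≡⟨ cong (_* 1/ r) pr≡qr ⟩
  q * r * 1/ r     ≡⟨ ℚ.*-assoc q r (1/ r) ⟩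
  q * (r * 1/ r)   ≡⟨ cong (q *_) (ℚ.*-inverseʳ r) ⟩
  q * 1ℚ           ≡⟨ ℚ.*-identityʳ q ⟩
  q                ∎
  where open ≡-Reasoning

square-pos : ∀ {p} → p ≢ 0ℚ → 0ℚ < p * p
square-pos {p} p≢0 with ℚ.<-cmp p 0ℚ
... | tri< p<0 _ _ = ℚ.positive⁻¹ (p * p) {{ℚ.neg*neg⇒pos p {{ℚ.negative p<0}} p {{ℚ.negative p<0}}}}
... | tri≈ _ p≡0 _ = contradiction p≡0 p≢0
... | tri> _ _ p>0 = ℚ.positive⁻¹ (p * p) {{ℚ.pos*pos⇒pos p {{ℚ.positive p>0}} p {{ℚ.positive p>0}}}}

weighted-square-pos : ∀ {c p} → 0ℚ < c → p ≢ 0ℚ → 0ℚ < c * (p * p)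
weighted-square-pos {c} {p} c>0 p≢0 =
  ℚ.positive⁻¹ (c * (p * p)) {{ℚ.pos*pos⇒pos c {{ℚ.positive c>0}} (p * p) {{ℚ.positive (square-pos p≢0)}}}}

weighted-square-nonNeg : ∀ {c} p → 0ℚ < c → 0ℚ ≤ c * (p * p)
weighted-square-nonNeg {c} p c>0 with p ℚ.≟ 0ℚ
... | yes refl = ℚ.≤-reflexive (sym (ℚ.*-zeroʳ c))
... | no p≢0  = ℚ.<⇒≤ (weighted-square-pos c>0 p≢0)

diagonal-form-pos : ∀ {c₀ c₁ c₂ c₃} → 0ℚ < c₀ → 0ℚ < c₁ → 0ℚ < c₂ → 0ℚ < c₃ →
  ∀ {x₀ x₁ x₂ x₃} → quat x₀ x₁ x₂ x₃ ≢ quat 0ℚ 0ℚ 0ℚ 0ℚ →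
  0ℚ < c₀ * (x₀ * x₀) + c₁ * (x₁ * x₁) + c₂ * (x₂ * x₂) + c₃ * (x₃ * x₃)
diagonal-form-pos 0<c₀ 0<c₁ 0<c₂ 0<c₃ {x₀} {x₁} {x₂} {x₃} x≢0
  with x₀ ℚ.≟ 0ℚ | x₁ ℚ.≟ 0ℚ | x₂ ℚ.≟ 0ℚ | x₃ ℚ.≟ 0ℚ
... | no x₀≢0 | _ | _ | _ =
  +-mono-<-≤ (+-mono-<-≤ (+-mono-<-≤ (weighted-square-pos 0<c₀ x₀≢0)
    (weighted-square-nonNeg x₁ 0<c₁)) (weighted-square-nonNeg x₂ 0<c₂)) (weighted-square-nonNeg x₃ 0<c₃)
... | yes _ | no x₁≢0 | _ | _ =
  +-mono-<-≤ (+-mono-<-≤ (+-mono-≤-< (weighted-square-nonNeg x₀ 0<c₀)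
    (weighted-square-pos 0<c₁ x₁≢0)) (weighted-square-nonNeg x₂ 0<c₂)) (weighted-square-nonNeg x₃ 0<c₃)
... | yes _ | yes _ | no x₂≢0 | _ =
  +-mono-<-≤ (+-mono-≤-< (+-mono-≤ (weighted-square-nonNeg x₀ 0<c₀)
    (weighted-square-nonNeg x₁ 0<c₁)) (weighted-square-pos 0<c₂ x₂≢0)) (weighted-square-nonNeg x₃ 0<c₃)
... | yes _ | yes _ | yes _ | no x₃≢0 =
  +-mono-≤-< (+-mono-≤ (+-mono-≤ (weighted-square-nonNeg x₀ 0<c₀)
    (weighted-square-nonNeg x₁ 0<c₁)) (weighted-square-nonNeg x₂ 0<c₂)) (weighted-square-pos 0<c₃ x₃≢0)
... | yes refl | yes refl | yes refl | yes refl = contradiction refl x≢0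

record Quatᴾ (n : ℕ) : Set where
  constructor quatᴾ
  field
    p₀ p₁ p₂ p₃ : Polynomial n
open Quatᴾ

-- The operations of QuaternionAlgebra A B, transcribed to solver polynomials: an identity
-- between quaternions is proved by one solver call per coordinate.
module Symbolic {n : ℕ} (A B : Polynomial n) where

  1ᴾ : Quatᴾ n
  1ᴾ = quatᴾ (con 1ℚ) (con 0ℚ) (con 0ℚ) (con 0ℚ)

  _⊕ᴾ_ : Quatᴾ n → Quatᴾ n → Quatᴾ n
  quatᴾ x₀ x₁ x₂ x₃ ⊕ᴾ quatᴾ y₀ y₁ y₂ y₃ = quatᴾ (x₀ :+ y₀) (x₁ :+ y₁) (x₂ :+ y₂) (x₃ :+ y₃)

  _·ᴾ_ : Polynomial n → Quatᴾ n → Quatᴾ n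
  r ·ᴾ quatᴾ x₀ x₁ x₂ x₃ = quatᴾ (r :* x₀) (r :* x₁) (r :* x₂) (r :* x₃)

  _⊗ᴾ_ : Quatᴾ n → Quatᴾ n → Quatᴾ n
  quatᴾ x₀ x₁ x₂ x₃ ⊗ᴾ quatᴾ y₀ y₁ y₂ y₃ = quatᴾ
    (x₀ :* y₀ :+ A :* x₁ :* y₁ :+ B :* x₂ :* y₂ :- A :* B :* x₃ :* y₃)
    (x₀ :* y₁ :+ x₁ :* y₀ :- B :* x₂ :* y₃ :+ B :* x₃ :* y₂)
    (x₀ :* y₂ :+ x₂ :* y₀ :+ A :* x₁ :* y₃ :- A :* x₃ :* y₁)
    (x₀ :* y₃ :+ x₃ :* y₀ :+ x₁ :* y₂ :- x₂ :* y₁)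

  nrdᴾ : Quatᴾ n → Polynomial n
  nrdᴾ (quatᴾ x₀ x₁ x₂ x₃) = x₀ :* x₀ :- A :* x₁ :* x₁ :- B :* x₂ :* x₂ :+ A :* B :* x₃ :* x₃

  Δᴾ : Quatᴾ n → Polynomial n
  Δᴾ x = (p₀ x :+ p₀ x) :* (p₀ x :+ p₀ x) :- con (ℕ→ℚ 4) :* nrdᴾ x

Componentwise : ∀ n → Set (N-ary-level 0ℓ 0ℓ n)
Componentwise n = (Quatᴾ n → Polynomial n) → N-ary n (Polynomial n) (Polynomial n × Polynomial n)

quat-cong : ∀ {x₀ x₁ x₂ x₃ y₀ y₁ y₂ y₃} → x₀ ≡ y₀ → x₁ ≡ y₁ → x₂ ≡ y₂ → x₃ ≡ y₃ →
         quat x₀ x₁ x₂ x₃ ≡ quat y₀ y₁ y₂ y₃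
quat-cong refl refl refl refl = refl

module QuaternionIdentities (a b : ℚ) where
  open QuaternionAlgebra a b

  ⊗-identityˡ : ∀ x → 1H ⊗ x ≡ x
  ⊗-identityˡ (quat x₀ x₁ x₂ x₃) = quat-cong
    (solve 6 (on p₀) refl a b x₀ x₁ x₂ x₃) (solve 6 (on p₁) refl a b x₀ x₁ x₂ x₃)
    (solve 6 (on p₂) refl a b x₀ x₁ x₂ x₃) (solve 6 (on p₃) refl a b x₀ x₁ x₂ x₃)
    where
    on : Componentwise 6
    on c A B X₀ X₁ X₂ X₃ = let open Symbolic A B; X = quatᴾ X₀ X₁ X₂ X₃ in
      c (1ᴾ ⊗ᴾ X) := c X

  ·-⊗-assoc : ∀ r x y → (r · x) ⊗ y ≡ r · (x ⊗ y)
  ·-⊗-assoc r (quat x₀ x₁ x₂ x₃) (quat y₀ y₁ y₂ y₃) = quat-cong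
    (solve 11 (on p₀) refl a b r x₀ x₁ x₂ x₃ y₀ y₁ y₂ y₃)
    (solve 11 (on p₁) refl a b r x₀ x₁ x₂ x₃ y₀ y₁ y₂ y₃)
    (solve 11 (on p₂) refl a b r x₀ x₁ x₂ x₃ y₀ y₁ y₂ y₃)
    (solve 11 (on p₃) refl a b r x₀ x₁ x₂ x₃ y₀ y₁ y₂ y₃)
    where
    on : Componentwise 11
    on c A B R X₀ X₁ X₂ X₃ Y₀ Y₁ Y₂ Y₃ =
      let open Symbolic A B; X = quatᴾ X₀ X₁ X₂ X₃; Y = quatᴾ Y₀ Y₁ Y₂ Y₃ in
      c ((R ·ᴾ X) ⊗ᴾ Y) := c (R ·ᴾ (X ⊗ᴾ Y))

  ⊕1H-⊗ : ∀ x y → (x ⊕ 1H) ⊗ y ≡ (x ⊗ y) ⊕ y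
  ⊕1H-⊗ (quat x₀ x₁ x₂ x₃) (quat y₀ y₁ y₂ y₃) = quat-cong
    (solve 10 (on p₀) refl a b x₀ x₁ x₂ x₃ y₀ y₁ y₂ y₃)
    (solve 10 (on p₁) refl a b x₀ x₁ x₂ x₃ y₀ y₁ y₂ y₃)
    (solve 10 (on p₂) refl a b x₀ x₁ x₂ x₃ y₀ y₁ y₂ y₃)
    (solve 10 (on p₃) refl a b x₀ x₁ x₂ x₃ y₀ y₁ y₂ y₃)
    where
    on : Componentwise 10
    on c A B X₀ X₁ X₂ X₃ Y₀ Y₁ Y₂ Y₃ =
      let open Symbolic A B; X = quatᴾ X₀ X₁ X₂ X₃; Y = quatᴾ Y₀ Y₁ Y₂ Y₃ in
      c ((X ⊕ᴾ 1ᴾ) ⊗ᴾ Y) := c ((X ⊗ᴾ Y) ⊕ᴾ Y)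

  ⊗-⊕1H : ∀ x y → x ⊗ (y ⊕ 1H) ≡ (x ⊗ y) ⊕ x
  ⊗-⊕1H (quat x₀ x₁ x₂ x₃) (quat y₀ y₁ y₂ y₃) = quat-cong
    (solve 10 (on p₀) refl a b x₀ x₁ x₂ x₃ y₀ y₁ y₂ y₃)
    (solve 10 (on p₁) refl a b x₀ x₁ x₂ x₃ y₀ y₁ y₂ y₃)
    (solve 10 (on p₂) refl a b x₀ x₁ x₂ x₃ y₀ y₁ y₂ y₃)
    (solve 10 (on p₃) refl a b x₀ x₁ x₂ x₃ y₀ y₁ y₂ y₃)
    where
    on : Componentwise 10
    on c A B X₀ X₁ X₂ X₃ Y₀ Y₁ Y₂ Y₃ =
      let open Symbolic A B; X = quatᴾ X₀ X₁ X₂ X₃; Y = quatᴾ Y₀ Y₁ Y₂ Y₃ in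
      c (X ⊗ᴾ (Y ⊕ᴾ 1ᴾ)) := c ((X ⊗ᴾ Y) ⊕ᴾ X)

  nrd-⊗ : ∀ x y → nrd (x ⊗ y) ≡ nrd x * nrd y
  nrd-⊗ (quat x₀ x₁ x₂ x₃) (quat y₀ y₁ y₂ y₃) = solve 10
    (λ A B X₀ X₁ X₂ X₃ Y₀ Y₁ Y₂ Y₃ →
      let open Symbolic A B; X = quatᴾ X₀ X₁ X₂ X₃; Y = quatᴾ Y₀ Y₁ Y₂ Y₃ in
      nrdᴾ (X ⊗ᴾ Y) := nrdᴾ X :* nrdᴾ Y)
    refl a b x₀ x₁ x₂ x₃ y₀ y₁ y₂ y₃

  Δ-· : ∀ r x → Δ (r · x) ≡ r * r * Δ x
  Δ-· r (quat x₀ x₁ x₂ x₃) = solve 7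
    (λ A B R X₀ X₁ X₂ X₃ → let open Symbolic A B; X = quatᴾ X₀ X₁ X₂ X₃ in
      Δᴾ (R ·ᴾ X) := R :* R :* Δᴾ X)
    refl a b r x₀ x₁ x₂ x₃

  -- trd x = nrd (x + 1) - nrd x - 1, so Δ x is a function of these two norms.
  discriminant : ℚ → ℚ → ℚ
  discriminant u v = (v - u - 1ℚ) * (v - u - 1ℚ) - ℕ→ℚ 4 * u

  Δ-via-nrd : ∀ x → Δ x ≡ discriminant (nrd x) (nrd (x ⊕ 1H))
  Δ-via-nrd (quat x₀ x₁ x₂ x₃) = solve 6
    (λ A B X₀ X₁ X₂ X₃ →
      let open Symbolic A B; X = quatᴾ X₀ X₁ X₂ X₃; u = nrdᴾ X; v = nrdᴾ (X ⊕ᴾ 1ᴾ) in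
      Δᴾ X := (v :- u :- con 1ℚ) :* (v :- u :- con 1ℚ) :- con (ℕ→ℚ 4) :* u)
    refl a b x₀ x₁ x₂ x₃

module Conjugation (a b : ℚ) where
  open QuaternionAlgebra a b
  open QuaternionIdentities a b

  Δ-conj : ∀ x y z → nrd y ≢ 0ℚ → y ⊗ x ≡ z ⊗ y → Δ z ≡ Δ x
  Δ-conj x y z nrd[y]≢0 yx≡zy = begin
    Δ z                                  ≡⟨ Δ-via-nrd z ⟩
    discriminant (nrd z) (nrd (z ⊕ 1H))
      ≡⟨ cong₂ discriminant (nrd-conj x z yx≡zy) (nrd-conj (x ⊕ 1H) (z ⊕ 1H) y[x+1]≡[z+1]y) ⟩
    discriminant (nrd x) (nrd (x ⊕ 1H))  ≡⟨ sym (Δ-via-nrd x) ⟩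
    Δ x                                  ∎
    where
    open ≡-Reasoning
    instance
      nrd[y]-nonZero : ℚ.NonZero (nrd y)
      nrd[y]-nonZero = ℚ.≢-nonZero nrd[y]≢0
    nrd-conj : ∀ u v → y ⊗ u ≡ v ⊗ y → nrd v ≡ nrd u
    nrd-conj u v yu≡vy = *-cancelʳ-≡ (nrd v) (nrd u) (nrd y) (begin
      nrd v * nrd y  ≡⟨ sym (nrd-⊗ v y) ⟩
      nrd (v ⊗ y)    ≡⟨ cong nrd (sym yu≡vy) ⟩
      nrd (y ⊗ u)    ≡⟨ nrd-⊗ y u ⟩
      nrd y * nrd u  ≡⟨ ℚ.*-comm (nrd y) (nrd u) ⟩
      nrd u * nrd y  ∎)
    y[x+1]≡[z+1]y : y ⊗ (x ⊕ 1H) ≡ (z ⊕ 1H) ⊗ y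
    y[x+1]≡[z+1]y = begin
      y ⊗ (x ⊕ 1H)     ≡⟨ ⊗-⊕1H y x ⟩
      (y ⊗ x) ⊕ y      ≡⟨ cong (_⊕ y) yx≡zy ⟩
      (z ⊗ y) ⊕ y      ≡⟨ sym (⊕1H-⊗ z y) ⟩
      (z ⊕ 1H) ⊗ y     ∎

module Definite (a b : ℚ) (a<0 : a < 0ℚ) (b<0 : b < 0ℚ) where
  open QuaternionAlgebra a b

  nrd-weighted-squares : ∀ x₀ x₁ x₂ x₃ → nrd (quat x₀ x₁ x₂ x₃) ≡
    1ℚ * (x₀ * x₀) + (- a) * (x₁ * x₁) + (- b) * (x₂ * x₂) + (a * b) * (x₃ * x₃)
  nrd-weighted-squares x₀ x₁ x₂ x₃ = solve 6
    (λ A B X₀ X₁ X₂ X₃ → let open Symbolic A B in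
      nrdᴾ (quatᴾ X₀ X₁ X₂ X₃) :=
        con 1ℚ :* (X₀ :* X₀) :+ (:- A) :* (X₁ :* X₁) :+ (:- B) :* (X₂ :* X₂) :+ (A :* B) :* (X₃ :* X₃))
    refl a b x₀ x₁ x₂ x₃

  0<-a : 0ℚ < - a
  0<-a = ℚ.neg-antimono-< a<0

  0<-b : 0ℚ < - b
  0<-b = ℚ.neg-antimono-< b<0

  0<ab : 0ℚ < a * b
  0<ab = ℚ.positive⁻¹ (a * b) {{ℚ.neg*neg⇒pos a {{ℚ.negative a<0}} b {{ℚ.negative b<0}}}}

  nrd-pos : ∀ {x} → x ≢ 0H → 0ℚ < nrd x
  nrd-pos {quat x₀ x₁ x₂ x₃} x≢0 =
    subst (0ℚ <_) (sym (nrd-weighted-squares x₀ x₁ x₂ x₃)) (diagonal-form-pos (ℚ.positive⁻¹ 1ℚ) 0<-a 0<-b 0<ab x≢0)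

module Localisation (a b : ℚ) where
  open QuaternionAlgebra a b
  open QuaternionIdentities a b

  1H-∈-at : ∀ {q} (O : Order) → Prime q → 1H ∈ lattice O at q
  1H-∈-at O q-prime = 1 , (λ q∣1 → ¬prime[1] (subst Prime (∣1⇒≡1 q∣1) q-prime)) , one∈ O

  ∈Oᵣ-⊗-at : ∀ {q x y 𝔞} → x ∈Oᵣ 𝔞 → y ∈ 𝔞 at q → (y ⊗ x) ∈ 𝔞 at q
  ∈Oᵣ-⊗-at {x = x} {y} {𝔞} x∈Oᵣ (m , q∤m , m·y∈𝔞) =
    m , q∤m , subst (_∈L 𝔞) (·-⊗-assoc (ℕ→ℚ m) y x) (x∈Oᵣ (ℕ→ℚ m · y) m·y∈𝔞)

  ∈Oᵣ⇒conjugate-at : ∀ O 𝔞 x {q} → IsLeftIdeal O 𝔞 → x ∈Oᵣ 𝔞 → Prime q →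
    ∃[ y ] y ≢ 0H × ∃[ z ] z ∈ lattice O at q × y ⊗ x ≡ z ⊗ y
  ∈Oᵣ⇒conjugate-at O 𝔞 x {q} 𝔞-ideal x∈Oᵣ q-prime with 𝔞-ideal q q-prime
  ... | y , y≢0 , 𝔞≡O·y = y , y≢0 , proj₁ (𝔞≡O·y (y ⊗ x)) (∈Oᵣ-⊗-at {𝔞 = 𝔞} x∈Oᵣ y∈𝔞)
    where
    y∈𝔞 : y ∈ 𝔞 at q
    y∈𝔞 = proj₂ (𝔞≡O·y y) (1H , 1H-∈-at O q-prime , sym (⊗-identityˡ y))

  divides-neg⇒∣ : ∀ {w n} → w divides (- ℕ→ℚ n) → w ∣ n
  divides-neg⇒∣ {w} {n} (k , -n≡wk) = subst (w ∣_) (sym n≡w*k) (m∣m*n ℤ.∣ k ∣)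
    where
    open ≡-Reasoning
    n≡w*k : n ≡ w ℕ.* ℤ.∣ k ∣
    n≡w*k = begin
      n                 ≡⟨ sym (ℤ.∣-i∣≡∣i∣ (+ n)) ⟩
      ℤ.∣ ℤ.- (+ n) ∣   ≡⟨ cong ℤ.∣_∣ (ℤ→ℚ-injective {ℤ.- (+ n)} {+ w ℤ.* k} (trans (sym (ℤ→ℚ-homo-neg (+ n))) -n≡wk)) ⟩
      ℤ.∣ + w ℤ.* k ∣   ≡⟨ ℤ.abs-* (+ w) k ⟩
      w ℕ.* ℤ.∣ k ∣     ∎

  ω∣Δ⇒∣ₗ-at : ∀ O w d {q z} → (∀ x → x ∈O O → w divides Δ x) → Prime q →
    z ∈ lattice O at q → Δ z ≡ - ℕ→ℚ d → ∃[ m ] ¬ q ∣ m × w ∣ m ℕ.* d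
  ω∣Δ⇒∣ₗ-at O w d {q} {z} ω∣Δ q-prime (m , q∤m , m·z∈O) Δz≡-d =
    m ℕ.* m , q∤m*m , divides-neg⇒∣ (subst (w divides_) Δ[m·z]≡-m*m*d (ω∣Δ (ℕ→ℚ m · z) m·z∈O))
    where
    open ≡-Reasoning
    q∤m*m : ¬ q ∣ m ℕ.* m
    q∤m*m = [ q∤m , q∤m ]′ ∘ euclidsLemma m m q-prime
    Δ[m·z]≡-m*m*d : Δ (ℕ→ℚ m · z) ≡ - ℕ→ℚ (m ℕ.* m ℕ.* d)
    Δ[m·z]≡-m*m*d = begin
      Δ (ℕ→ℚ m · z)                    ≡⟨ Δ-· (ℕ→ℚ m) z ⟩
      ℕ→ℚ m * ℕ→ℚ m * Δ z              ≡⟨ cong (ℕ→ℚ m * ℕ→ℚ m *_) Δz≡-d ⟩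
      ℕ→ℚ m * ℕ→ℚ m * - ℕ→ℚ d          ≡⟨ sym (ℚ.neg-distribʳ-* (ℕ→ℚ m * ℕ→ℚ m) (ℕ→ℚ d)) ⟩
      - (ℕ→ℚ m * ℕ→ℚ m * ℕ→ℚ d)        ≡⟨ cong (λ t → - (t * ℕ→ℚ d)) (ℕ→ℚ-homo-* m m) ⟩
      - (ℕ→ℚ (m ℕ.* m) * ℕ→ℚ d)        ≡⟨ cong -_ (ℕ→ℚ-homo-* (m ℕ.* m) d) ⟩
      - ℕ→ℚ (m ℕ.* m ℕ.* d)            ∎

mainTheorem7 : (a b : ℚ) → a < 0ℚ → b < 0ℚ →
    (O : QuaternionAlgebra.Order a b) → (d w : ℕ) → QuaternionAlgebra.IsOmega a b O w →
    ¬ (w ∣ d) → QuaternionAlgebra.eZero a b O d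
mainTheorem7 a b a<0 b<0 O d w (w≢0 , ω∣Δ , _) w∤d 𝔞 𝔞-ideal _ (x , x∈Oᵣ , Δx≡-d) =
  w∤d (∣ₗ⇒∣ w≢0 w∣ₗd)
  where
  open Conjugation a b
  open Definite a b a<0 b<0
  open Localisation a b
  w∣ₗd : w ∣ₗ d
  w∣ₗd q q-prime =
    let y , y≢0 , z , z∈O , yx≡zy = ∈Oᵣ⇒conjugate-at O 𝔞 x 𝔞-ideal x∈Oᵣ q-prime
        Δz≡Δx = Δ-conj x y z (≢-sym (ℚ.<⇒≢ (nrd-pos y≢0))) yx≡zy
    in ω∣Δ⇒∣ₗ-at O w d ω∣Δ q-prime z∈O (trans Δz≡Δx Δx≡-d)
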